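{- Let $k,p$ be positive integers, let $G(k,p)$ be the multigraph defined below, and let $C\subseteq E(G(k,p))$ be the edge set of a cycle of $G(k,p)$ with $|C|=k+1$. Define $f_C\colon 2^{E(G(k,p))}\to\mathbb{N}$ by $f_C(X)=f(X)$ for $X\ne C$ and $f_C(C)=2^{k+1}-2$, where $f$ is defined below. Then $f_C$ is submodular.
   Context: $G(k,p)$ has vertex set $\{v_1,\ldots,v_{k+1}\}$; for each $1\le i\le k$ there are $p$ parallel edges $F_i=\{e_i^1,\ldots,e_i^p\}$ with endpoints $v_i,v_{i+1}$, and one further edge $e_{k+1}$ joining $v_1$ and $v_{k+1}$; so it has $pk+1$ edges. For $X\subseteq E(G(k,p))$: if $|X|\ge k+1$ or $|X\cap F_i|\ge 2$ for some $i$, then $f(X)=2^{k+1}-1$; otherwise $f(X)=2^{k+1}-2^{k+1-|X|}$. A function $h\colon 2^U\to\mathbb{R}$ is submodular if $h(X)+h(Y)\ge h(X\cup Y)+h(X\cap Y)$ for all $X,Y\subseteq U$. -}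

module Defs where

open import Data.Nat using (ℕ; zero; suc; _+_; _*_; _∸_; _^_; _≤_; _≤ᵇ_)
open import Data.Fin using (Fin; zero; suc; inject₁; fromℕ)
open import Data.Bool using (Bool; true; false; _∧_; _∨_; if_then_else_)
open import Data.Unit using (⊤; tt)
open import Data.Sum using (_⊎_; inj₁; inj₂)
open import Data.Product using (Σ; _×_; _,_; ∃-syntax)
open import Data.List using (List; _∷_; []; _++_; map; filter; length; allFin; cartesianProduct)
open import Data.Bool.ListAction using (all; any)
open import Relation.Binary.PropositionalEquality using (_≡_)
open import Function.Definitions using (Injective)
open import Function.Bundles using (_⇔_)

-- Vertices v_1 … v_{k+1} are Fin (suc k) (0-indexed).
Vertex : ℕ → Set
Vertex k = Fin (suc k)

-- Edges of G(k,p): inj₁ (i , j) is e_{i+1}^{j+1} ∈ F_{i+1}; inj₂ tt is e_{k+1}.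
Edge : ℕ → ℕ → Set
Edge k p = (Fin k × Fin p) ⊎ ⊤

ends : ∀ {k p} → Edge k p → Vertex k × Vertex k
ends (inj₁ (i , _)) = inject₁ i , suc i
ends {k} (inj₂ _)   = zero , fromℕ k

Joins : ∀ {k p} → Edge k p → Vertex k → Vertex k → Set
Joins e u v = (ends e ≡ (u , v)) ⊎ (ends e ≡ (v , u))

allEdges : (k p : ℕ) → List (Edge k p)
allEdges k p = map inj₁ (cartesianProduct (allFin k) (allFin p)) ++ (inj₂ tt ∷ [])

EdgeSet : ℕ → ℕ → Set
EdgeSet k p = Edge k p → Bool

_∪_ : ∀ {k p} → EdgeSet k p → EdgeSet k p → EdgeSet k p
(X ∪ Y) e = X e ∨ Y e

_∩_ : ∀ {k p} → EdgeSet k p → EdgeSet k p → EdgeSet k p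
(X ∩ Y) e = X e ∧ Y e

card : ∀ {k p} → EdgeSet k p → ℕ
card {k} {p} X = length (filter (λ e → X e ≡? true) (allEdges k p))
  where
  open import Data.Bool.Properties using () renaming (_≟_ to _≡?_)

cardF : ∀ {k p} → EdgeSet k p → Fin k → ℕ
cardF {k} {p} X i = length (filter (λ j → X (inj₁ (i , j)) ≡? true) (allFin p))
  where
  open import Data.Bool.Properties using () renaming (_≟_ to _≡?_)

f : ∀ {k p} → EdgeSet k p → ℕ
f {k} X =
  if ((suc k ≤ᵇ card X) ∨ any (λ i → 2 ≤ᵇ cardF X i) (allFin k))
  then 2 ^ suc k ∸ 1
  else 2 ^ suc k ∸ 2 ^ (suc k ∸ card X)

sameSet : ∀ {k p} → EdgeSet k p → EdgeSet k p → Bool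
sameSet {k} {p} X Y = all (λ e → eqB (X e) (Y e)) (allEdges k p)
  where
  eqB : Bool → Bool → Bool
  eqB true true = true
  eqB false false = true
  eqB _ _ = false

fC : ∀ {k p} → EdgeSet k p → EdgeSet k p → ℕ
fC {k} C X = if sameSet X C then 2 ^ suc k ∸ 2 else f X

cyc : ∀ {n} → Fin (suc n) → Fin (suc n)
cyc {zero} zero = zero
cyc {suc n} zero = suc zero
cyc {suc n} (suc i) with cyc {n} i
... | zero = zero
... | suc j = suc (suc j)

IsCycle : ∀ {k p} → EdgeSet k p → Set
IsCycle {k} {p} C =
  Σ ℕ λ m →
  Σ (Fin (suc m) → Vertex k) λ us →
  Σ (Fin (suc m) → Edge k p) λ es →
    Injective _≡_ _≡_ us × Injective _≡_ _≡_ es ×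
    (∀ j → Joins (es j) (us j) (us (cyc j))) ×
    (∀ e → (C e ≡ true) ⇔ (∃[ j ] es j ≡ e))

Submodular : ∀ {A : Set} → ((A → Bool) → ℕ) → Set
Submodular {A} h = ∀ (X Y : A → Bool) →
  h (λ a → X a ∨ Y a) + h (λ a → X a ∧ Y a) ≤ h X + h Y

-- Put ρ(X) = |X| for independent X (at most k edges, at most one from each F_i),
-- ρ(X) = k + 1 for dependent X ≠ C, and ρ(C) = k.  Then f_C = φ ∘ ρ with
-- φ(c) = 2^(k+1) − 2^(k+1−c).  As φ is increasing and concave, the submodular inequality
-- for f_C holds at X, Y whenever ρ(X ∪ Y) + ρ(X ∩ Y) ≤ ρ(X) + ρ(Y).  That fails only if
-- X ∪ Y is dependent while ρ(X), ρ(Y) ≤ k; since every proper subset of C is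
-- independent, X ∩ Y then has rank strictly below both ρ(X) and ρ(Y) (otherwise X and Y
-- would be comparable), and φ is so steep at the bottom that
-- φ(d) + φ(a) ≤ φ(b) + φ(c) whenever a < b and a < c.
module Submission where

open import Defs
open import Data.Bool using (Bool; true; false; _∧_; _∨_; if_then_else_; T; T?)
open import Data.Bool.Properties using (_≟_; T-∨; T-≡; ∨-zeroʳ)
open import Data.Empty using (⊥-elim)
open import Data.Fin using (Fin; zero; suc; toℕ)
import Data.Fin.Properties as Fin
open import Data.List using (List; []; _∷_; _++_; map; filter; length; allFin; cartesianProduct)
open import Data.List.Membership.Propositional using (_∈_; lose)
open import Data.List.Membership.Propositional.Properties
  using (∈-allFin; ∈-map⁺; ∈-map⁻; ∈-++⁺ˡ; ∈-++⁺ʳ; ∈-cartesianProduct⁺)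
open import Data.List.Properties using (filter-++; filter-none; length-++)
open import Data.List.Relation.Unary.All as All using (All; [])
open import Data.List.Relation.Unary.All.Properties using (all⁺; all⁻; ¬All⇒Any¬)
open import Data.Bool.ListAction using (any)
open import Data.List.Relation.Unary.AllPairs using ([]; _∷_)
open import Data.List.Relation.Unary.Any using (here; there; satisfied)
open import Data.List.Relation.Unary.Any.Properties using (any⁺; any⁻)
open import Data.List.Relation.Unary.Unique.Propositional using (Unique)
import Data.List.Relation.Unary.Unique.Propositional.Properties as Unique
open import Data.Nat hiding (_≟_)
open import Data.Nat.Properties hiding (_≟_)
open import Data.Nat.Solver using (module +-*-Solver)
open import Algebra.Properties.CommutativeSemigroup +-commutativeSemigroup using (interchange)
open import Data.Product using (_×_; _,_; proj₁; proj₂) renaming (swap to ×-swap)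
import Data.Product.Properties as Product
open import Data.Sum using (_⊎_; inj₁; inj₂; [_,_]′; swap) renaming (map to ⊎-map)
import Data.Sum.Properties as Sum
open import Data.Unit using (tt)
import Data.Unit.Properties as Unit
open import Function using (_∘_; Equivalence)
open import Relation.Binary using (DecidableEquality)
open import Relation.Binary.PropositionalEquality
open import Relation.Nullary using (¬_; yes; no; does; contradiction)
open import Relation.Nullary.Decidable using (dec-true)

private
  variable
    A B : Set

count : (A → Bool) → List A → ℕ
count q xs = length (filter (λ x → q x ≟ true) xs)

count-++ : ∀ (q : A → Bool) xs ys → count q (xs ++ ys) ≡ count q xs + count q ys
count-++ q xs ys = trans (cong length (filter-++ (λ x → q x ≟ true) xs ys)) (length-++ (filter _ xs))

count-map : ∀ (q : B → Bool) (g : A → B) xs → count q (map g xs) ≡ count (q ∘ g) xs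
count-map q g [] = refl
count-map q g (x ∷ xs) with q (g x)
... | true  = cong suc (count-map q g xs)
... | false = count-map q g xs

module _ {q q′ : A → Bool} (q⊆q′ : ∀ x → q x ≡ true → q′ x ≡ true) where

  count-mono : ∀ xs → count q xs ≤ count q′ xs
  count-mono [] = z≤n
  count-mono (x ∷ xs) with q x in qx | q′ x in q′x
  ... | true  | true  = s≤s (count-mono xs)
  ... | false | true  = m≤n⇒m≤1+n (count-mono xs)
  ... | false | false = count-mono xs
  ... | true  | false = contradiction (trans (sym (q⊆q′ x qx)) q′x) λ ()

  count-<-mono : ∀ {y xs} → y ∈ xs → q y ≡ false → q′ y ≡ true → count q xs < count q′ xs
  count-<-mono {xs = x ∷ xs} (here refl) qx q′x rewrite qx | q′x = s≤s (count-mono xs)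
  count-<-mono {xs = x ∷ xs} (there y∈xs) qy q′y with q x in qx | q′ x in q′x
  ... | true  | true  = s≤s (count-<-mono y∈xs qy q′y)
  ... | false | true  = m<n⇒m<1+n (count-<-mono y∈xs qy q′y)
  ... | false | false = count-<-mono y∈xs qy q′y
  ... | true  | false = contradiction (trans (sym (q⊆q′ x qx)) q′x) λ ()

count-∨+count-∧ : ∀ (q q′ : A → Bool) xs →
  count (λ x → q x ∨ q′ x) xs + count (λ x → q x ∧ q′ x) xs ≡ count q xs + count q′ xs
count-∨+count-∧ q q′ [] = refl
count-∨+count-∧ q q′ (x ∷ xs) with q x | q′ x
... | true  | true  = cong suc (trans (+-suc _ _) (trans (cong suc (count-∨+count-∧ q q′ xs)) (sym (+-suc _ _))))
... | true  | false = cong suc (count-∨+count-∧ q q′ xs)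
... | false | true  = trans (cong suc (count-∨+count-∧ q q′ xs)) (sym (+-suc _ _))
... | false | false = count-∨+count-∧ q q′ xs

count-≤1 : ∀ {q : A → Bool} {xs} → Unique xs →
  (∀ {x y} → q x ≡ true → q y ≡ true → x ≡ y) → count q xs ≤ 1
count-≤1 {xs = []} _ _ = z≤n
count-≤1 {q = q} {x ∷ xs} (x∉xs ∷ unique) q-unique with q x in qx
... | false = count-≤1 unique q-unique
... | true  = s≤s (≤-reflexive (cong length
                  (filter-none (λ y → q y ≟ true) (All.map (λ x≢y qy → x≢y (q-unique qx qy)) x∉xs))))

count-cartesianProduct : ∀ (q : A × B → Bool) {i is} → i ∈ is → ∀ ys →
  count (λ j → q (i , j)) ys ≤ count q (cartesianProduct is ys)
count-cartesianProduct q {i} {_ ∷ is} (here refl) ys = begin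
  count (λ j → q (i , j)) ys                              ≡⟨ count-map q (i ,_) ys ⟨
  count q (map (i ,_) ys)                                 ≤⟨ m≤m+n _ _ ⟩
  count q (map (i ,_) ys) + count q (cartesianProduct is ys) ≡⟨ count-++ q (map (i ,_) ys) _ ⟨
  count q (cartesianProduct (i ∷ is) ys)                  ∎
  where
  open ≤-Reasoning
count-cartesianProduct q {i} {x ∷ is} (there i∈is) ys = begin
  count (λ j → q (i , j)) ys                              ≤⟨ count-cartesianProduct q i∈is ys ⟩
  count q (cartesianProduct is ys)                        ≤⟨ m≤n+m _ _ ⟩
  count q (map (x ,_) ys) + count q (cartesianProduct is ys) ≡⟨ count-++ q (map (x ,_) ys) _ ⟨
  count q (cartesianProduct (x ∷ is) ys)                  ∎
  where
  open ≤-Reasoning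

m+n≤m*n+1 : ∀ {m n} → 1 ≤ m → 1 ≤ n → m + n ≤ m * n + 1
m+n≤m*n+1 {suc m} {suc n} _ _ = begin
  suc m + suc n               ≤⟨ m≤m+n _ (m * n) ⟩
  suc m + suc n + m * n       ≡⟨ solve 2 (λ m n → (con 1 :+ m) :+ (con 1 :+ n) :+ m :* n
                                               := (con 1 :+ m) :* (con 1 :+ n) :+ con 1) refl m n ⟩
  suc m * suc n + 1           ∎
  where
  open ≤-Reasoning
  open +-*-Solver

2^-convex : ∀ s t m → 2 ^ (t + m) + 2 ^ (s + m) ≤ 2 ^ m + 2 ^ (s + t + m)
2^-convex s t m = begin
  2 ^ (t + m) + 2 ^ (s + m)         ≡⟨ cong₂ _+_ (^-distribˡ-+-* 2 t m) (^-distribˡ-+-* 2 s m) ⟩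
  y * z + x * z                     ≡⟨ solve 3 (λ x y z → y :* z :+ x :* z := (x :+ y) :* z) refl x y z ⟩
  (x + y) * z                       ≤⟨ *-monoˡ-≤ z (m+n≤m*n+1 (m^n>0 2 s) (m^n>0 2 t)) ⟩
  (x * y + 1) * z                   ≡⟨ solve 3 (λ x y z → (x :* y :+ con 1) :* z := z :+ x :* y :* z) refl x y z ⟩
  z + x * y * z                     ≡⟨ cong (z +_) (cong (_* z) (^-distribˡ-+-* 2 s t)) ⟨
  z + 2 ^ (s + t) * z               ≡⟨ cong (z +_) (^-distribˡ-+-* 2 (s + t) m) ⟨
  2 ^ m + 2 ^ (s + t + m)           ∎
  where
  open ≤-Reasoning
  open +-*-Solver
  x y z : ℕ
  x = 2 ^ s
  y = 2 ^ t
  z = 2 ^ m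

2^[n∸1+m]-halves : ∀ n m → 2 ^ (n ∸ suc m) + 2 ^ (n ∸ suc m) ≤ 2 ^ (n ∸ m) + 1
2^[n∸1+m]-halves zero    zero    = ≤-refl
2^[n∸1+m]-halves zero    (suc m) = ≤-refl
2^[n∸1+m]-halves (suc n) zero    =
  ≤-trans (m≤m+n _ 1) (+-monoˡ-≤ 1 (≤-reflexive (cong (2 ^ n +_) (sym (+-identityʳ (2 ^ n))))))
2^[n∸1+m]-halves (suc n) (suc m) = 2^[n∸1+m]-halves n m

∸-exchange : ∀ n {x y z w} → x ≤ n → y ≤ n → z + w ≤ x + y →
  (n ∸ x) + (n ∸ y) ≤ (n ∸ z) + (n ∸ w)
∸-exchange n {x} {y} {z} {w} x≤n y≤n z+w≤x+y =
  +-cancelʳ-≤ (z + w) ((n ∸ x) + (n ∸ y)) ((n ∸ z) + (n ∸ w)) (begin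
  (n ∸ x) + (n ∸ y) + (z + w)   ≤⟨ +-monoʳ-≤ ((n ∸ x) + (n ∸ y)) z+w≤x+y ⟩
  (n ∸ x) + (n ∸ y) + (x + y)   ≡⟨ interchange (n ∸ x) (n ∸ y) x y ⟩
  (n ∸ x) + x + ((n ∸ y) + y)   ≡⟨ cong₂ _+_ (m∸n+n≡m x≤n) (m∸n+n≡m y≤n) ⟩
  n + n                         ≤⟨ +-mono-≤ (n≤n∸m+m z) (n≤n∸m+m w) ⟩
  (n ∸ z) + z + ((n ∸ w) + w)   ≡⟨ interchange (n ∸ z) (n ∸ w) z w ⟨
  (n ∸ z) + (n ∸ w) + (z + w)   ∎)
  where
  open ≤-Reasoning
  n≤n∸m+m : ∀ m → n ≤ (n ∸ m) + m
  n≤n∸m+m m = ≤-trans (m≤n+m∸n n m) (≤-reflexive (+-comm m (n ∸ m)))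

module Exponential (e : ℕ) where

  ψ : ℕ → ℕ
  ψ c = 2 ^ (e ∸ c)

  φ : ℕ → ℕ
  φ c = 2 ^ e ∸ ψ c

  ψ-antitone : ∀ {c c′} → c ≤ c′ → ψ c′ ≤ ψ c
  ψ-antitone c≤c′ = ^-monoʳ-≤ 2 (∸-monoʳ-≤ e c≤c′)

  ψ≤2^e : ∀ c → ψ c ≤ 2 ^ e
  ψ≤2^e c = ^-monoʳ-≤ 2 (m∸n≤m e c)

  ψ-split : ∀ c r → c + r ≡ e → ψ c ≡ 2 ^ r
  ψ-split c r c+r≡e = trans (cong (λ n → 2 ^ (n ∸ c)) (sym c+r≡e)) (cong (2 ^_) (m+n∸m≡n c r))

  ψ-convex : ∀ a s t → a + s + t ≤ e → ψ (a + s) + ψ (a + t) ≤ ψ (a + s + t) + ψ a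
  ψ-convex a s t d≤e with m≤n⇒∃[o]m+o≡n d≤e
  ... | m , d+m≡e = begin
    ψ (a + s) + ψ (a + t)     ≡⟨ cong₂ _+_ (ψ-split′ (a + s) (t + m) [a+s]+[t+m])
                                           (ψ-split′ (a + t) (s + m) [a+t]+[s+m]) ⟩
    2 ^ (t + m) + 2 ^ (s + m) ≤⟨ 2^-convex s t m ⟩
    2 ^ m + 2 ^ (s + t + m)   ≡⟨ cong₂ _+_ (ψ-split′ (a + s + t) m refl)
                                           (ψ-split′ a (s + t + m) a+[s+t+m]) ⟨
    ψ (a + s + t) + ψ a       ∎
    where
    open ≤-Reasoning
    open +-*-Solver
    ψ-split′ : ∀ c r → c + r ≡ a + s + t + m → ψ c ≡ 2 ^ r
    ψ-split′ c r c+r≡d+m = ψ-split c r (trans c+r≡d+m d+m≡e)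
    [a+s]+[t+m] : (a + s) + (t + m) ≡ a + s + t + m
    [a+s]+[t+m] = solve 4 (λ a s t m → (a :+ s) :+ (t :+ m) := a :+ s :+ t :+ m) refl a s t m
    [a+t]+[s+m] : (a + t) + (s + m) ≡ a + s + t + m
    [a+t]+[s+m] = solve 4 (λ a s t m → (a :+ t) :+ (s :+ m) := a :+ s :+ t :+ m) refl a s t m
    a+[s+t+m] : a + (s + t + m) ≡ a + s + t + m
    a+[s+t+m] = solve 4 (λ a s t m → a :+ (s :+ t :+ m) := a :+ s :+ t :+ m) refl a s t m

  ψ-to-φ : ∀ a b c d → ψ b + ψ c ≤ ψ d + ψ a → φ d + φ a ≤ φ b + φ c
  ψ-to-φ a b c d = ∸-exchange (2 ^ e) {z = ψ b} {ψ c} (ψ≤2^e d) (ψ≤2^e a)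

  φ-concave : ∀ {a b c d} → a ≤ b → b ≤ d → d ≤ e → d + a ≤ b + c → φ d + φ a ≤ φ b + φ c
  φ-concave {a} {c = c} a≤b b≤d d≤e d+a≤b+c with m≤n⇒∃[o]m+o≡n a≤b | m≤n⇒∃[o]m+o≡n b≤d
  ... | s , refl | t , refl = ψ-to-φ a (a + s) c (a + s + t) (begin
    ψ (a + s) + ψ c             ≤⟨ +-monoʳ-≤ (ψ (a + s)) (ψ-antitone a+t≤c) ⟩
    ψ (a + s) + ψ (a + t)       ≤⟨ ψ-convex a s t d≤e ⟩
    ψ (a + s + t) + ψ a         ∎)
    where
    open ≤-Reasoning
    open +-*-Solver
    a+t≤c : a + t ≤ c
    a+t≤c = +-cancelˡ-≤ (a + s) _ _ (begin
      a + s + (a + t)   ≡⟨ solve 3 (λ a s t → a :+ s :+ (a :+ t) := a :+ s :+ t :+ a) refl a s t ⟩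
      a + s + t + a     ≤⟨ d+a≤b+c ⟩
      a + s + c         ∎)

  φ-steep : ∀ {a b c d} → a < b → a < c → φ d + φ a ≤ φ b + φ c
  φ-steep {a} {b} {c} {d} a<b a<c = ψ-to-φ a b c d (begin
    ψ b + ψ c                   ≤⟨ +-mono-≤ (ψ-antitone a<b) (ψ-antitone a<c) ⟩
    ψ (suc a) + ψ (suc a)       ≤⟨ 2^[n∸1+m]-halves e a ⟩
    ψ a + 1                     ≤⟨ +-monoʳ-≤ (ψ a) (m^n>0 2 (e ∸ d)) ⟩
    ψ a + ψ d                   ≡⟨ +-comm (ψ a) (ψ d) ⟩
    ψ d + ψ a                   ∎)
    where
    open ≤-Reasoning

toℕ-cyc : ∀ {n} (i : Fin (suc n)) →
  (toℕ i < n × toℕ (cyc i) ≡ suc (toℕ i)) ⊎ (toℕ i ≡ n × cyc i ≡ zero)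
toℕ-cyc {zero}  zero    = inj₂ (refl , refl)
toℕ-cyc {suc n} zero    = inj₁ (s≤s z≤n , refl)
toℕ-cyc {suc n} (suc i) with cyc {n} i | toℕ-cyc {n} i
... | zero  | inj₂ (i≡n , _)     = inj₂ (cong suc i≡n , refl)
... | suc j | inj₁ (i<n , j≡1+i) = inj₁ (s≤s i<n , cong suc j≡1+i)

cyc²≡id⇒n≤1 : ∀ {n} (i : Fin (suc n)) → cyc (cyc i) ≡ i → n ≤ 1
cyc²≡id⇒n≤1 i cyc²i≡i with toℕ-cyc i | toℕ-cyc (cyc i)
... | inj₁ (_ , ci≡1+i) | inj₁ (_ , cci≡1+ci) =
  contradiction (trans (cong toℕ (sym cyc²i≡i)) (trans cci≡1+ci (cong suc ci≡1+i))) (m≢1+n+m _ {1})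
... | inj₁ (_ , ci≡1+i) | inj₂ (ci≡n , cci≡0) =
  ≤-reflexive (trans (sym ci≡n) (trans ci≡1+i (cong (suc ∘ toℕ) (trans (sym cyc²i≡i) cci≡0))))
... | inj₂ (i≡n , ci≡0) | inj₁ (_ , cci≡1+ci) =
  ≤-reflexive (trans (sym i≡n) (trans (cong toℕ (sym cyc²i≡i)) (trans cci≡1+ci (cong (suc ∘ toℕ) ci≡0))))
... | inj₂ (i≡n , ci≡0) | inj₂ (ci≡n , _) =
  subst (_≤ 1) (trans (cong toℕ (sym ci≡0)) ci≡n) z≤n

Fin≤2-cover : ∀ {n} → n ≤ 1 → (t t′ s : Fin (suc n)) → t ≢ t′ → s ≡ t ⊎ s ≡ t′
Fin≤2-cover z≤n       zero       zero       _          t≢t′ = contradiction refl t≢t′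
Fin≤2-cover (s≤s z≤n) zero       zero       _          t≢t′ = contradiction refl t≢t′
Fin≤2-cover (s≤s z≤n) (suc zero) (suc zero) _          t≢t′ = contradiction refl t≢t′
Fin≤2-cover (s≤s z≤n) zero       (suc zero) zero       _    = inj₁ refl
Fin≤2-cover (s≤s z≤n) zero       (suc zero) (suc zero) _    = inj₂ refl
Fin≤2-cover (s≤s z≤n) (suc zero) zero       zero       _    = inj₂ refl
Fin≤2-cover (s≤s z≤n) (suc zero) zero       (suc zero) _    = inj₁ refl

module _ {V : Set} {u v u′ v′ : V} {P : V × V} where

  endpoints-match : P ≡ (u , v) ⊎ P ≡ (v , u) → P ≡ (u′ , v′) ⊎ P ≡ (v′ , u′) →
    (u ≡ u′ × v ≡ v′) ⊎ (u ≡ v′ × v ≡ u′)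
  endpoints-match (inj₁ refl) (inj₁ eq) = inj₁ (Product.,-injective eq)
  endpoints-match (inj₁ refl) (inj₂ eq) = inj₂ (Product.,-injective eq)
  endpoints-match (inj₂ refl) (inj₁ eq) = inj₂ (×-swap (Product.,-injective eq))
  endpoints-match (inj₂ refl) (inj₂ eq) = inj₁ (×-swap (Product.,-injective eq))

cycle-with-parallel-edges : ∀ {k p} {C : EdgeSet k p} {a b : Edge k p} → IsCycle C →
  a ≢ b → ends a ≡ ends b → C a ≡ true → C b ≡ true → ∀ e → C e ≡ true → e ≡ a ⊎ e ≡ b
cycle-with-parallel-edges (m , us , es , us-inj , _ , joins , C⇔) a≢b same-ends Ca Cb e Ce
  with Equivalence.to (C⇔ _) Ca | Equivalence.to (C⇔ _) Cb | Equivalence.to (C⇔ e) Ce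
... | t , refl | t′ , refl | s , refl = ⊎-map (cong es) (cong es) (Fin≤2-cover m≤1 t t′ s t≢t′)
  where
  t≢t′ : t ≢ t′
  t≢t′ refl = a≢b refl
  -- Parallel edges at positions t ≠ t′ are traversed in opposite directions, so the cycle has length two.
  crossed : us t ≡ us (cyc t′) × us (cyc t) ≡ us t′
  crossed with endpoints-match (joins t) (subst (λ P → P ≡ _ ⊎ P ≡ _) (sym same-ends) (joins t′))
  ... | inj₁ (ut≡ut′ , _) = contradiction (us-inj ut≡ut′) t≢t′
  ... | inj₂ ut≡uct′×uct≡ut′ = ut≡uct′×uct≡ut′
  m≤1 : m ≤ 1
  m≤1 = cyc²≡id⇒n≤1 t (trans (cong cyc (us-inj (proj₂ crossed))) (sym (us-inj (proj₁ crossed))))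

module _ {k p : ℕ} where

  infix 4 _⊆_ _≐_

  _⊆_ : EdgeSet k p → EdgeSet k p → Set
  X ⊆ Y = ∀ e → X e ≡ true → Y e ≡ true

  _≐_ : EdgeSet k p → EdgeSet k p → Set
  X ≐ Y = ∀ e → X e ≡ Y e

  ⊆-refl : ∀ {X} → X ⊆ X
  ⊆-refl _ Xe = Xe

  ⊆-trans : ∀ {X Y Z} → X ⊆ Y → Y ⊆ Z → X ⊆ Z
  ⊆-trans X⊆Y Y⊆Z e Xe = Y⊆Z e (X⊆Y e Xe)

  ≐⇒⊆ : ∀ {X Y} → X ≐ Y → X ⊆ Y
  ≐⇒⊆ X≐Y e Xe = trans (sym (X≐Y e)) Xe

  ≐⇒⊇ : ∀ {X Y} → X ≐ Y → Y ⊆ X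
  ≐⇒⊇ X≐Y e Ye = trans (X≐Y e) Ye

  ⊆-antisym : ∀ {X Y} → X ⊆ Y → Y ⊆ X → X ≐ Y
  ⊆-antisym {X} {Y} X⊆Y Y⊆X e with X e in Xe | Y e in Ye
  ... | true  | true  = refl
  ... | false | false = refl
  ... | true  | false = trans (sym (X⊆Y e Xe)) Ye
  ... | false | true  = trans (sym Xe) (Y⊆X e Ye)

  ∩-⊆ˡ : ∀ X Y → X ∩ Y ⊆ X
  ∩-⊆ˡ X Y e XYe with X e
  ... | true = refl

  ∩-⊆ʳ : ∀ X Y → X ∩ Y ⊆ Y
  ∩-⊆ʳ X Y e XYe with X e
  ... | true = XYe

  ⊆-∪ˡ : ∀ X Y → X ⊆ X ∪ Y
  ⊆-∪ˡ X Y e Xe rewrite Xe = refl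

  ⊆-∪ʳ : ∀ X Y → Y ⊆ X ∪ Y
  ⊆-∪ʳ X Y e Ye rewrite Ye = ∨-zeroʳ (X e)

  ∪-least : ∀ {X Y Z} → X ⊆ Z → Y ⊆ Z → X ∪ Y ⊆ Z
  ∪-least {X} X⊆Z Y⊆Z e XYe with X e in Xe
  ... | true  = X⊆Z e Xe
  ... | false = Y⊆Z e XYe

  ∈-allEdges : ∀ e → e ∈ allEdges k p
  ∈-allEdges (inj₁ (i , j)) = ∈-++⁺ˡ (∈-map⁺ inj₁ (∈-cartesianProduct⁺ (∈-allFin i) (∈-allFin j)))
  ∈-allEdges (inj₂ tt)      = ∈-++⁺ʳ _ (here refl)

  _≟ᴱ_ : DecidableEquality (Edge k p)
  _≟ᴱ_ = Sum.≡-dec (Product.≡-dec Fin._≟_ Fin._≟_) Unit._≟_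

  allEdges-unique : Unique (allEdges k p)
  allEdges-unique = Unique.++⁺
    (Unique.map⁺ Sum.inj₁-injective (Unique.cartesianProduct⁺ (Unique.allFin⁺ k) (Unique.allFin⁺ p)))
    ([] ∷ [])
    inj₂∉map-inj₁
    where
    inj₂∉map-inj₁ : ∀ {e} → ¬ (e ∈ map inj₁ (cartesianProduct (allFin k) (allFin p)) × e ∈ inj₂ tt ∷ [])
    inj₂∉map-inj₁ (e∈map-inj₁ , here refl) with ∈-map⁻ inj₁ e∈map-inj₁
    ... | _ , _ , ()

  card-mono : ∀ {X Y} → X ⊆ Y → card X ≤ card Y
  card-mono X⊆Y = count-mono X⊆Y (allEdges k p)

  card-cong : ∀ {X Y} → X ≐ Y → card X ≡ card Y
  card-cong X≐Y = ≤-antisym (card-mono (≐⇒⊆ X≐Y)) (card-mono (≐⇒⊇ X≐Y))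

  ⊆∧card≥⇒⊇ : ∀ {X Y} → X ⊆ Y → card Y ≤ card X → Y ⊆ X
  ⊆∧card≥⇒⊇ {X} X⊆Y |Y|≤|X| e Ye with X e in Xe
  ... | true  = refl
  ... | false = contradiction |Y|≤|X| (<⇒≱ (count-<-mono X⊆Y (∈-allEdges e) Xe Ye))

  card-∪+card-∩ : ∀ X Y → card (X ∪ Y) + card (X ∩ Y) ≡ card X + card Y
  card-∪+card-∩ X Y = count-∨+count-∧ X Y (allEdges k p)

  card≤2 : ∀ {X} a b → (∀ e → X e ≡ true → e ≡ a ⊎ e ≡ b) → card X ≤ 2
  card≤2 {X} a b X⊆ab = begin
    card X                                      ≤⟨ count-mono X⊆is-a∨is-b (allEdges k p) ⟩
    count (λ e → is a e ∨ is b e) (allEdges k p) ≤⟨ m≤m+n _ _ ⟩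
    count (λ e → is a e ∨ is b e) (allEdges k p) + count (λ e → is a e ∧ is b e) (allEdges k p)
                                                ≡⟨ count-∨+count-∧ (is a) (is b) (allEdges k p) ⟩
    count (is a) (allEdges k p) + count (is b) (allEdges k p)
                                                ≤⟨ +-mono-≤ (count-≤1 allEdges-unique (is-unique a))
                                                            (count-≤1 allEdges-unique (is-unique b)) ⟩
    2                                           ∎
    where
    open ≤-Reasoning
    is : Edge k p → Edge k p → Bool
    is a e = does (e ≟ᴱ a)
    is-sound : ∀ {a e} → is a e ≡ true → e ≡ a
    is-sound {a} {e} _ with e ≟ᴱ a
    ... | yes e≡a = e≡a
    is-unique : ∀ a {e e′} → is a e ≡ true → is a e′ ≡ true → e ≡ e′
    is-unique a ae ae′ = trans (is-sound ae) (sym (is-sound ae′))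
    X⊆is-a∨is-b : ∀ e → X e ≡ true → is a e ∨ is b e ≡ true
    X⊆is-a∨is-b e Xe with X⊆ab e Xe
    ... | inj₁ refl rewrite dec-true (e ≟ᴱ e) refl = refl
    ... | inj₂ refl rewrite dec-true (e ≟ᴱ e) refl = ∨-zeroʳ (is a e)

  cardF-mono : ∀ {X Y} → X ⊆ Y → ∀ i → cardF X i ≤ cardF Y i
  cardF-mono X⊆Y i = count-mono (λ j → X⊆Y (inj₁ (i , j))) (allFin p)

  cardF≤card : ∀ X i → cardF X i ≤ card X
  cardF≤card X i = begin
    cardF X i                                  ≤⟨ count-cartesianProduct (X ∘ inj₁) (∈-allFin i) (allFin p) ⟩
    count (X ∘ inj₁) pairs                     ≡⟨ count-map X inj₁ pairs ⟨
    count X (map inj₁ pairs)                   ≤⟨ m≤m+n _ _ ⟩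
    count X (map inj₁ pairs) + count X (inj₂ tt ∷ []) ≡⟨ count-++ X (map inj₁ pairs) _ ⟨
    card X                                     ∎
    where
    open ≤-Reasoning
    pairs : List (Fin k × Fin p)
    pairs = cartesianProduct (allFin k) (allFin p)

  Independent : EdgeSet k p → Set
  Independent X = card X ≤ k × (∀ i → cardF X i ≤ 1)

  independent-⊆ : ∀ {X Y} → X ⊆ Y → Independent Y → Independent X
  independent-⊆ X⊆Y (|Y|≤k , Y≤1) =
    ≤-trans (card-mono X⊆Y) |Y|≤k , λ i → ≤-trans (cardF-mono X⊆Y i) (Y≤1 i)

  dependentᵇ : EdgeSet k p → Bool
  dependentᵇ X = (suc k ≤ᵇ card X) ∨ any (λ i → 2 ≤ᵇ cardF X i) (allFin k)

  dependentᵇ≡true⇒¬independent : ∀ {X} → dependentᵇ X ≡ true → ¬ Independent X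
  dependentᵇ≡true⇒¬independent dep (|X|≤k , ≤1) with Equivalence.to T-∨ (Equivalence.from T-≡ dep)
  ... | inj₁ large = <⇒≱ (s≤s |X|≤k) (≤ᵇ⇒≤ _ _ large)
  ... | inj₂ parallel with satisfied (any⁻ _ (allFin k) parallel)
  ...   | i , two = <⇒≱ (s≤s (≤1 i)) (≤ᵇ⇒≤ 2 _ two)

  dependentᵇ≡false⇒independent : ∀ {X} → dependentᵇ X ≡ false → Independent X
  dependentᵇ≡false⇒independent {X} ¬dep =
    ≮⇒≥ (λ large → not-dependent (inj₁ (≤⇒≤ᵇ large))) ,
    λ i → ≮⇒≥ (λ two → not-dependent (inj₂ (any⁺ _ (lose (∈-allFin i) (≤⇒≤ᵇ two)))))
    where
    not-dependent : ¬ (T (suc k ≤ᵇ card X) ⊎ T (any (λ i → 2 ≤ᵇ cardF X i) (allFin k)))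
    not-dependent d = subst T ¬dep (Equivalence.from T-∨ d)

  sameSet-sound : ∀ {X Y} → sameSet X Y ≡ true → X ≐ Y
  sameSet-sound {X} {Y} same e
    with Equivalence.to T-≡ (All.lookup (all⁺ _ _ (Equivalence.from T-≡ same)) (∈-allEdges e))
  ... | agree with X e | Y e
  ...   | true  | true  = refl
  ...   | false | false = refl

  sameSet-complete : ∀ {X Y} → X ≐ Y → sameSet X Y ≡ true
  sameSet-complete {X} {Y} X≐Y with sameSet X Y in same
  ... | true  = refl
  ... | false with satisfied (¬All⇒Any¬ (T? ∘ _) (allEdges k p) (λ agree → subst T same (all⁻ _ agree)))
  ...   | e , disagree with X e | Y e | X≐Y e
  ...     | true  | true  | refl = ⊥-elim (disagree tt)
  ...     | false | false | refl = ⊥-elim (disagree tt)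

  sameSet≡false⇒¬≐ : ∀ {X Y} → sameSet X Y ≡ false → ¬ X ≐ Y
  sameSet≡false⇒¬≐ different X≐Y = contradiction (trans (sym (sameSet-complete X≐Y)) different) λ ()

  cycle-parallel-classes : ∀ {C} → IsCycle C → card C ≡ suc k → k ≤ 1 ⊎ (∀ i → cardF C i ≤ 1)
  cycle-parallel-classes {C} cycle |C|≡1+k with k ≤? 1
  ... | yes k≤1 = inj₁ k≤1
  ... | no  k≰1 = inj₂ λ i → count-≤1 (Unique.allFin⁺ p) (same-class i)
    where
    same-class : ∀ i {j j′} → C (inj₁ (i , j)) ≡ true → C (inj₁ (i , j′)) ≡ true → j ≡ j′
    same-class i {j} {j′} Cj Cj′ with j Fin.≟ j′
    ... | yes j≡j′ = j≡j′
    ... | no  j≢j′ = contradiction (s≤s⁻¹ (subst (_≤ 2) |C|≡1+k (card≤2 _ _ C⊆jj′))) k≰1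
      where
      C⊆jj′ : ∀ e → C e ≡ true → e ≡ inj₁ (i , j) ⊎ e ≡ inj₁ (i , j′)
      C⊆jj′ = cycle-with-parallel-edges cycle (j≢j′ ∘ Product.,-injectiveʳ ∘ Sum.inj₁-injective) refl Cj Cj′

  proper-subcycle-independent : ∀ {C Z} → IsCycle C → card C ≡ suc k →
    Z ⊆ C → ¬ Z ≐ C → Independent Z
  proper-subcycle-independent {C} {Z} cycle |C|≡1+k Z⊆C Z≢C =
    |Z|≤k , [ (λ k≤1 i → ≤-trans (cardF≤card Z i) (≤-trans |Z|≤k k≤1))
            , (λ C≤1 i → ≤-trans (cardF-mono Z⊆C i) (C≤1 i)) ]′ (cycle-parallel-classes cycle |C|≡1+k)
    where
    |Z|≤k : card Z ≤ k
    |Z|≤k = ≮⇒≥ λ k<|Z| →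
      Z≢C (⊆-antisym Z⊆C (⊆∧card≥⇒⊇ Z⊆C (subst (_≤ card Z) (sym |C|≡1+k) k<|Z|)))

module Circuit {k p : ℕ} (C : EdgeSet k p) (|C|≡1+k : card C ≡ suc k)
  (proper⇒independent : ∀ {Z} → Z ⊆ C → ¬ Z ≐ C → Independent Z) where

  open Exponential (suc k)

  ρ : EdgeSet k p → ℕ
  ρ X = if sameSet X C then k else if dependentᵇ X then suc k else card X

  fC≡φ∘ρ : ∀ X → fC C X ≡ φ (ρ X)
  fC≡φ∘ρ X with sameSet X C
  ... | true = cong (λ n → 2 ^ suc k ∸ 2 ^ n) (sym (m+n∸n≡m 1 k))
  ... | false with dependentᵇ X
  ...   | true  = cong (λ n → 2 ^ suc k ∸ 2 ^ n) (sym (n∸n≡0 (suc k)))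
  ...   | false = refl

  data Kind (X : EdgeSet k p) : Set where
    circuit     : X ≐ C → Kind X
    dependent   : ¬ X ≐ C → ¬ Independent X → Kind X
    independent : Independent X → Kind X

  kind : ∀ X → Kind X
  kind X with sameSet X C in same | dependentᵇ X in dep
  ... | true  | _     = circuit (sameSet-sound same)
  ... | false | true  = dependent (sameSet≡false⇒¬≐ same) (dependentᵇ≡true⇒¬independent dep)
  ... | false | false = independent (dependentᵇ≡false⇒independent dep)

  independent⇒¬≐C : ∀ {X} → Independent X → ¬ X ≐ C
  independent⇒¬≐C (|X|≤k , _) X≐C = 1+n≰n (subst (_≤ k) (trans (card-cong X≐C) |C|≡1+k) |X|≤k)

  ρ-circuit : ∀ {X} → X ≐ C → ρ X ≡ k
  ρ-circuit X≐C rewrite sameSet-complete X≐C = refl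

  ρ-circuits : ∀ {X Y} → X ≐ C → Y ≐ C → ρ X ≡ ρ Y
  ρ-circuits X≐C Y≐C = trans (ρ-circuit X≐C) (sym (ρ-circuit Y≐C))

  ρ-dependent : ∀ {X} → ¬ X ≐ C → ¬ Independent X → ρ X ≡ suc k
  ρ-dependent {X} X≢C ¬indX with sameSet X C in same | dependentᵇ X in dep
  ... | true  | _     = contradiction (sameSet-sound same) X≢C
  ... | false | true  = refl
  ... | false | false = contradiction (dependentᵇ≡false⇒independent dep) ¬indX

  ρ-independent : ∀ {X} → Independent X → ρ X ≡ card X
  ρ-independent {X} indX with sameSet X C in same | dependentᵇ X in dep
  ... | true  | _     = contradiction (sameSet-sound same) (independent⇒¬≐C indX)
  ... | false | true  = contradiction indX (dependentᵇ≡true⇒¬independent dep)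
  ... | false | false = refl

  ρ≤1+k : ∀ X → ρ X ≤ suc k
  ρ≤1+k X with kind X
  ... | circuit X≐C          = ≤-trans (≤-reflexive (ρ-circuit X≐C)) (n≤1+n k)
  ... | dependent X≢C ¬indX  = ≤-reflexive (ρ-dependent X≢C ¬indX)
  ... | independent indX     = ≤-trans (≤-reflexive (ρ-independent indX)) (m≤n⇒m≤1+n (proj₁ indX))

  ρ-dependent≰k : ∀ {X} → ¬ X ≐ C → ¬ Independent X → ¬ ρ X ≤ k
  ρ-dependent≰k X≢C ¬indX ρX≤k = 1+n≰n (subst (_≤ k) (ρ-dependent X≢C ¬indX) ρX≤k)

  ⊆C⇒circuit⊎independent : ∀ {Z} → Z ⊆ C → Z ≐ C ⊎ Independent Z
  ⊆C⇒circuit⊎independent {Z} Z⊆C with kind Z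
  ... | circuit Z≐C         = inj₁ Z≐C
  ... | dependent Z≢C ¬indZ = contradiction (proper⇒independent Z⊆C Z≢C) ¬indZ
  ... | independent indZ    = inj₂ indZ

  ρ-mono : ∀ {X Y} → X ⊆ Y → ρ X ≤ ρ Y
  ρ-mono {X} {Y} X⊆Y with kind Y
  ... | dependent Y≢C ¬indY = ≤-trans (ρ≤1+k X) (≤-reflexive (sym (ρ-dependent Y≢C ¬indY)))
  ... | independent indY    = subst₂ _≤_ (sym (ρ-independent (independent-⊆ X⊆Y indY)))
                                          (sym (ρ-independent indY)) (card-mono X⊆Y)
  ... | circuit Y≐C with ⊆C⇒circuit⊎independent (⊆-trans X⊆Y (≐⇒⊆ Y≐C))
  ...   | inj₁ X≐C  = ≤-reflexive (ρ-circuits X≐C Y≐C)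
  ...   | inj₂ indX = subst₂ _≤_ (sym (ρ-independent indX)) (sym (ρ-circuit Y≐C)) (proj₁ indX)

  ρ-saturated : ∀ {Z W} → Z ⊆ W → Independent W → ρ W ≤ ρ Z → W ⊆ Z
  ρ-saturated Z⊆W indW ρW≤ρZ = ⊆∧card≥⇒⊇ Z⊆W
    (subst₂ _≤_ (ρ-independent indW) (ρ-independent (independent-⊆ Z⊆W indW)) ρW≤ρZ)

  ρ-tight⇒comparable : ∀ {X Y Z} → Z ⊆ X → Z ⊆ Y → ρ X ≤ ρ Z → ρ X ≤ k → ρ Y ≤ k →
    X ⊆ Y ⊎ Y ⊆ X
  ρ-tight⇒comparable {X} {Y} {Z} Z⊆X Z⊆Y ρX≤ρZ ρX≤k ρY≤k with kind X
  ... | dependent X≢C ¬indX = contradiction ρX≤k (ρ-dependent≰k X≢C ¬indX)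
  ... | independent indX    = inj₁ (⊆-trans (ρ-saturated Z⊆X indX ρX≤ρZ) Z⊆Y)
  ... | circuit X≐C with kind Y
  ...   | dependent Y≢C ¬indY = contradiction ρY≤k (ρ-dependent≰k Y≢C ¬indY)
  ...   | circuit Y≐C         = inj₂ (⊆-trans (≐⇒⊆ Y≐C) (≐⇒⊇ X≐C))
  ...   | independent indY    = inj₂ (⊆-trans (ρ-saturated Z⊆Y indY ρY≤ρZ) Z⊆X)
    where
    ρY≤ρZ : ρ Y ≤ ρ Z
    ρY≤ρZ = ≤-trans ρY≤k (≤-trans (≤-reflexive (sym (ρ-circuit X≐C))) ρX≤ρZ)

  ρ-∩-strict : ∀ X Y → ρ X ≤ k → ρ Y ≤ k → k < ρ (X ∪ Y) →
    ρ (X ∩ Y) < ρ X × ρ (X ∩ Y) < ρ Y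
  ρ-∩-strict X Y ρX≤k ρY≤k k<ρU =
    ≤∧≢⇒< (ρ-mono (∩-⊆ˡ X Y)) ρI≢ρX , ≤∧≢⇒< (ρ-mono (∩-⊆ʳ X Y)) ρI≢ρY
    where
    incomparable : ¬ (X ⊆ Y ⊎ Y ⊆ X)
    incomparable (inj₁ X⊆Y) = <⇒≱ k<ρU (≤-trans (ρ-mono (∪-least X⊆Y ⊆-refl)) ρY≤k)
    incomparable (inj₂ Y⊆X) = <⇒≱ k<ρU (≤-trans (ρ-mono (∪-least ⊆-refl Y⊆X)) ρX≤k)
    ρI≢ρX : ρ (X ∩ Y) ≢ ρ X
    ρI≢ρX ρI≡ρX = incomparable
      (ρ-tight⇒comparable (∩-⊆ˡ X Y) (∩-⊆ʳ X Y) (≤-reflexive (sym ρI≡ρX)) ρX≤k ρY≤k)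
    ρI≢ρY : ρ (X ∩ Y) ≢ ρ Y
    ρI≢ρY ρI≡ρY = incomparable
      (swap (ρ-tight⇒comparable (∩-⊆ʳ X Y) (∩-⊆ˡ X Y) (≤-reflexive (sym ρI≡ρY)) ρY≤k ρX≤k))

  module _ (X Y : EdgeSet k p) where

    dominated : ρ (X ∪ Y) ≤ ρ X ⊎ ρ (X ∪ Y) ≤ ρ Y → ρ (X ∪ Y) + ρ (X ∩ Y) ≤ ρ X + ρ Y
    dominated (inj₁ ρU≤ρX) = +-mono-≤ ρU≤ρX (ρ-mono (∩-⊆ʳ X Y))
    dominated (inj₂ ρU≤ρY) =
      subst (ρ (X ∪ Y) + ρ (X ∩ Y) ≤_) (+-comm (ρ Y) (ρ X)) (+-mono-≤ ρU≤ρY (ρ-mono (∩-⊆ˡ X Y)))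

    independent-exchange : Independent X → Independent Y → ρ (X ∪ Y) ≤ card (X ∪ Y) →
      ρ (X ∪ Y) + ρ (X ∩ Y) ≤ ρ X + ρ Y
    independent-exchange indX indY ρU≤|U| = begin
      ρ (X ∪ Y) + ρ (X ∩ Y)       ≤⟨ +-monoˡ-≤ (ρ (X ∩ Y)) ρU≤|U| ⟩
      card (X ∪ Y) + ρ (X ∩ Y)    ≡⟨ cong (card (X ∪ Y) +_) (ρ-independent (independent-⊆ (∩-⊆ˡ X Y) indX)) ⟩
      card (X ∪ Y) + card (X ∩ Y) ≡⟨ card-∪+card-∩ X Y ⟩
      card X + card Y             ≡⟨ cong₂ _+_ (ρ-independent indX) (ρ-independent indY) ⟨
      ρ X + ρ Y                   ∎
      where
      open ≤-Reasoning

    ρ-exchange : ρ (X ∪ Y) + ρ (X ∩ Y) ≤ ρ X + ρ Y ⊎ (ρ (X ∩ Y) < ρ X × ρ (X ∩ Y) < ρ Y)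
    ρ-exchange with kind (X ∪ Y)
    ... | independent indU =
      inj₁ (independent-exchange (independent-⊆ (⊆-∪ˡ X Y) indU) (independent-⊆ (⊆-∪ʳ X Y) indU)
                                 (≤-reflexive (ρ-independent indU)))
    ... | circuit U≐C
      with ⊆C⇒circuit⊎independent (⊆-trans (⊆-∪ˡ X Y) (≐⇒⊆ U≐C))
         | ⊆C⇒circuit⊎independent (⊆-trans (⊆-∪ʳ X Y) (≐⇒⊆ U≐C))
    ...   | inj₁ X≐C  | _         = inj₁ (dominated (inj₁ (≤-reflexive (ρ-circuits U≐C X≐C))))
    ...   | inj₂ _    | inj₁ Y≐C  = inj₁ (dominated (inj₂ (≤-reflexive (ρ-circuits U≐C Y≐C))))
    ...   | inj₂ indX | inj₂ indY = inj₁ (independent-exchange indX indY (begin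
      ρ (X ∪ Y)     ≡⟨ ρ-circuit U≐C ⟩
      k             ≤⟨ n≤1+n k ⟩
      suc k         ≡⟨ trans (card-cong U≐C) |C|≡1+k ⟨
      card (X ∪ Y)  ∎))
      where
      open ≤-Reasoning
    ρ-exchange | dependent U≢C ¬indU with ρ X ≤? k | ρ Y ≤? k
    ... | yes ρX≤k | yes ρY≤k =
      inj₂ (ρ-∩-strict X Y ρX≤k ρY≤k (≤-reflexive (sym (ρ-dependent U≢C ¬indU))))
    ... | no ρX≰k  | _        = inj₁ (dominated (inj₁ (≤-trans (ρ≤1+k (X ∪ Y)) (≰⇒> ρX≰k))))
    ... | yes _    | no ρY≰k  = inj₁ (dominated (inj₂ (≤-trans (ρ≤1+k (X ∪ Y)) (≰⇒> ρY≰k))))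

  φ∘ρ-submodular : ∀ X Y → φ (ρ (X ∪ Y)) + φ (ρ (X ∩ Y)) ≤ φ (ρ X) + φ (ρ Y)
  φ∘ρ-submodular X Y with ρ-exchange X Y
  ... | inj₁ exchange = φ-concave (ρ-mono (∩-⊆ˡ X Y)) (ρ-mono (⊆-∪ˡ X Y)) (ρ≤1+k (X ∪ Y)) exchange
  ... | inj₂ (ρI<ρX , ρI<ρY) = φ-steep {d = ρ (X ∪ Y)} ρI<ρX ρI<ρY

lemma4p1 : (k p : ℕ) → 0 < k → 0 < p →
    (C : EdgeSet k p) → IsCycle C → card C ≡ suc k →
    Submodular (fC C)
lemma4p1 k p _ _ C cycle |C|≡1+k X Y = begin
  fC C (X ∪ Y) + fC C (X ∩ Y)     ≡⟨ cong₂ _+_ (fC≡φ∘ρ (X ∪ Y)) (fC≡φ∘ρ (X ∩ Y)) ⟩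
  φ (ρ (X ∪ Y)) + φ (ρ (X ∩ Y))   ≤⟨ φ∘ρ-submodular X Y ⟩
  φ (ρ X) + φ (ρ Y)               ≡⟨ cong₂ _+_ (fC≡φ∘ρ X) (fC≡φ∘ρ Y) ⟨
  fC C X + fC C Y                 ∎
  where
  open ≤-Reasoning
  open Exponential (suc k)
  open Circuit C |C|≡1+k (proper-subcycle-independent cycle |C|≡1+k)
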